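{- Modal logic with intuitionistic disjunction has the disjunction property with respect to intuitionistic disjunction: for all formulas $\varphi,\psi$ of this logic, the intuitionistic disjunction of $\varphi$ and $\psi$ is valid if and only if either $\varphi$ is valid or $\psi$ is valid.
   Context: Team semantics over Kripke models $\mathrm{K}=(W,R,V)$, with formulas evaluated on teams $T\subseteq W$. Modal logic with intuitionistic disjunction extends modal logic in negation normal form ($p,\neg p,\wedge,\vee,\Diamond,\Box$, with the team-semantic clauses: $p$ holds on $T$ iff it holds at every world of $T$; $\varphi\vee\psi$ holds on $T$ iff $T=T_1\cup T_2$ with $\varphi$ on $T_1$ and $\psi$ on $T_2$; $\Diamond\varphi$ holds on $T$ iff $\varphi$ holds on some $T'$ such that every world of $T$ has a successor in $T'$ and every world of $T'$ has a predecessor in $T$; $\Box\varphi$ holds on $T$ iff $\varphi$ holds on $R[T]$) by the intuitionistic disjunction, which holds on $T$ iff $\varphi$ holds on $T$ or $\psi$ holds on $T$. A formula is valid if it is true on every team of every Kripke model (interpreting its proposition symbols). -}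

module Defs where

open import Level using (Level; 0ℓ; Lift)
open import Data.Nat using (ℕ)
open import Data.Product using (Σ; ∃; _×_; _,_)
open import Data.Sum using (_⊎_)
open import Relation.Nullary using (¬_)
open import Relation.Unary using (Pred)

record Kripke : Set₁ where
  field
    W : Set
    R : W → W → Set
    V : ℕ → W → Set

-- Modal formulas in negation normal form, extended with intuitionistic disjunction.
data Form : Set where
  var  : ℕ → Form
  nvar : ℕ → Form
  _∧ᶠ_ : Form → Form → Form
  _∨ᶠ_ : Form → Form → Form       -- (tensor / split) disjunction
  ◇_   : Form → Form
  □_   : Form → Form
  _⩔_  : Form → Form → Form

Team : Kripke → Set₁
Team K = Pred (Kripke.W K) 0ℓ

_,_⊨_ : (K : Kripke) → Team K → Form → Set₁
K , T ⊨ var p    = Lift _ (∀ w → T w → Kripke.V K p w)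
K , T ⊨ nvar p   = Lift _ (∀ w → T w → ¬ Kripke.V K p w)
K , T ⊨ (φ ∧ᶠ ψ) = (K , T ⊨ φ) × (K , T ⊨ ψ)
K , T ⊨ (φ ∨ᶠ ψ) =
  Σ (Team K) λ T₁ → Σ (Team K) λ T₂ →
    (∀ w → T w → T₁ w ⊎ T₂ w) × (∀ w → T₁ w ⊎ T₂ w → T w)
    × (K , T₁ ⊨ φ) × (K , T₂ ⊨ ψ)
K , T ⊨ (◇ φ) =
  Σ (Team K) λ T' →
    (∀ w → T w → ∃ λ v → Kripke.R K w v × T' v)
    × (∀ v → T' v → ∃ λ w → T w × Kripke.R K w v)
    × (K , T' ⊨ φ)
K , T ⊨ (□ φ) = K , (λ v → ∃ λ w → T w × Kripke.R K w v) ⊨ φ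
K , T ⊨ (φ ⩔ ψ) = (K , T ⊨ φ) ⊎ (K , T ⊨ ψ)

Valid : Form → Set₁
Valid φ = (K : Kripke) (T : Team K) → K , T ⊨ φ

module Submission where

open import Defs
open import Data.Sum using (_⊎_)
open import Function.Bundles using (_⇔_)
open import Axiom.ExcludedMiddle using (ExcludedMiddle)

open import Level using (lift)
open import Data.Empty using (⊥; ⊥-elim)
open import Data.Product using (∃; _×_; _,_; proj₁; proj₂)
open import Data.Sum using (inj₁; inj₂; [_,_]) renaming (map to ⊎-map)
open import Function.Base using (id; _∘_)
open import Function.Bundles using (mk⇔)
open import Relation.Nullary using (yes; no)
open import Relation.Binary.PropositionalEquality using (_≡_; refl)

-- If φ ⩔ ψ is valid but φ fails on the team T₁ of K₁ and ψ fails on the team T₂ of K₂,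
-- then φ ⩔ ψ fails on T₁ ∪ T₂ in the disjoint union of K₁ and K₂: every formula is
-- downward closed and reflected along the inclusions of the components, so a disjunct
-- holding on T₁ ∪ T₂ would already hold on T₁ (resp. T₂).

record BoundedMorphism (K K' : Kripke) : Set where
  open Kripke
  field
    map     : W K → W K'
    V-forth : ∀ p w → V K p w → V K' p (map w)
    V-back  : ∀ p w → V K' p (map w) → V K p w
    R-forth : ∀ w v → R K w v → R K' (map w) (map v)
    R-back  : ∀ w v' → R K' (map w) v' → ∃ λ v → R K w v × map v ≡ v'

module _ {K K' : Kripke} (h : BoundedMorphism K K') where
  open BoundedMorphism h
  open Kripke

  -- T' only has to contain the image of T: this also builds in downward closure.
  ⊨-reflect : (φ : Form) (T : Team K) (T' : Team K') →
    (∀ w → T w → T' (map w)) → K' , T' ⊨ φ → K , T ⊨ φ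
  ⊨-reflect (var p)  T T' T⊆T' (lift holds) =
    lift λ w w∈T → V-back p w (holds (map w) (T⊆T' w w∈T))
  ⊨-reflect (nvar p) T T' T⊆T' (lift fails) =
    lift λ w w∈T → fails (map w) (T⊆T' w w∈T) ∘ V-forth p w
  ⊨-reflect (φ ∧ᶠ ψ) T T' T⊆T' (⊨φ , ⊨ψ) =
    ⊨-reflect φ T T' T⊆T' ⊨φ , ⊨-reflect ψ T T' T⊆T' ⊨ψ
  ⊨-reflect (φ ∨ᶠ ψ) T T' T⊆T' (T₁' , T₂' , T'⊆T₁'∪T₂' , _ , ⊨φ , ⊨ψ) =
    T₁ , T₂ , T⊆T₁∪T₂ , T₁∪T₂⊆T ,
    ⊨-reflect φ T₁ T₁' (λ _ → proj₂) ⊨φ , ⊨-reflect ψ T₂ T₂' (λ _ → proj₂) ⊨ψ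
    where
    T₁ T₂ : Team K
    T₁ w = T w × T₁' (map w)
    T₂ w = T w × T₂' (map w)

    T⊆T₁∪T₂ : ∀ w → T w → T₁ w ⊎ T₂ w
    T⊆T₁∪T₂ w w∈T = ⊎-map (w∈T ,_) (w∈T ,_) (T'⊆T₁'∪T₂' (map w) (T⊆T' w w∈T))

    T₁∪T₂⊆T : ∀ w → T₁ w ⊎ T₂ w → T w
    T₁∪T₂⊆T w = [ proj₁ , proj₁ ]
  ⊨-reflect (◇ φ) T T' T⊆T' (U' , U'-total , _ , ⊨φ) =
    U , U-total , (λ _ → proj₂) , ⊨-reflect φ U U' (λ _ → proj₁) ⊨φ
    where
    U : Team K
    U v = U' (map v) × ∃ λ w → T w × R K w v

    U-total : ∀ w → T w → ∃ λ v → R K w v × U v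
    U-total w w∈T with U'-total (map w) (T⊆T' w w∈T)
    ... | v' , Rwv' , v'∈U' with R-back w v' Rwv'
    ...   | v , Rwv , refl = v , Rwv , v'∈U' , w , w∈T , Rwv
  ⊨-reflect (□ φ) T T' T⊆T' ⊨φ =
    ⊨-reflect φ (λ v → ∃ λ w → T w × R K w v) (λ v' → ∃ λ w' → T' w' × R K' w' v')
      (λ { v (w , w∈T , Rwv) → map w , T⊆T' w w∈T , R-forth w v Rwv }) ⊨φ
  ⊨-reflect (φ ⩔ ψ) T T' T⊆T' =
    ⊎-map (⊨-reflect φ T T' T⊆T') (⊨-reflect ψ T T' T⊆T')

_⊎ᴷ_ : Kripke → Kripke → Kripke
K₁ ⊎ᴷ K₂ = record
  { W = W K₁ ⊎ W K₂
  ; R = R⊎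
  ; V = λ p → [ V K₁ p , V K₂ p ]
  }
  where
  open Kripke
  R⊎ : W K₁ ⊎ W K₂ → W K₁ ⊎ W K₂ → Set
  R⊎ (inj₁ w) (inj₁ v) = R K₁ w v
  R⊎ (inj₂ w) (inj₂ v) = R K₂ w v
  R⊎ _        _        = ⊥

inj₁-bounded : (K₁ K₂ : Kripke) → BoundedMorphism K₁ (K₁ ⊎ᴷ K₂)
inj₁-bounded K₁ K₂ = record
  { map = inj₁
  ; V-forth = λ _ _ → id
  ; V-back = λ _ _ → id
  ; R-forth = λ _ _ → id
  ; R-back = λ { w (inj₁ v) Rwv → v , Rwv , refl ; w (inj₂ v) () }
  }

inj₂-bounded : (K₁ K₂ : Kripke) → BoundedMorphism K₂ (K₁ ⊎ᴷ K₂)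
inj₂-bounded K₁ K₂ = record
  { map = inj₂
  ; V-forth = λ _ _ → id
  ; V-back = λ _ _ → id
  ; R-forth = λ _ _ → id
  ; R-back = λ { w (inj₂ v) Rwv → v , Rwv , refl ; w (inj₁ v) () }
  }

valid-⩔-splits : (φ ψ : Form) → Valid (φ ⩔ ψ) →
  (K₁ : Kripke) (T₁ : Team K₁) (K₂ : Kripke) (T₂ : Team K₂) →
  (K₁ , T₁ ⊨ φ) ⊎ (K₂ , T₂ ⊨ ψ)
valid-⩔-splits φ ψ valid K₁ T₁ K₂ T₂ =
  ⊎-map (⊨-reflect (inj₁-bounded K₁ K₂) φ T₁ T (λ _ → id))
        (⊨-reflect (inj₂-bounded K₁ K₂) ψ T₂ T (λ _ → id))
        (valid (K₁ ⊎ᴷ K₂) T)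
  where
  T : Team (K₁ ⊎ᴷ K₂)
  T = [ T₁ , T₂ ]

mainTheorem8 : (∀ {ℓ} → ExcludedMiddle ℓ) →
    (φ ψ : Form) → Valid (φ ⩔ ψ) ⇔ (Valid φ ⊎ Valid ψ)
mainTheorem8 em φ ψ = mk⇔ to from
  where
  from : Valid φ ⊎ Valid ψ → Valid (φ ⩔ ψ)
  from valid K T = ⊎-map (λ ⊨φ → ⊨φ K T) (λ ⊨ψ → ⊨ψ K T) valid

  to : Valid (φ ⩔ ψ) → Valid φ ⊎ Valid ψ
  to valid with em {P = Valid φ}
  ... | yes valid-φ = inj₁ valid-φ
  ... | no ¬valid-φ = inj₂ valid-ψ
    where
    valid-ψ : Valid ψ
    valid-ψ K₂ T₂ with em {P = K₂ , T₂ ⊨ ψ}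
    ... | yes ⊨ψ = ⊨ψ
    ... | no ⊭ψ = ⊥-elim (¬valid-φ λ K₁ T₁ →
                    [ id , ⊥-elim ∘ ⊭ψ ] (valid-⩔-splits φ ψ valid K₁ T₁ K₂ T₂))
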